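{- Let $k\ge 4$ be an even integer and $n\in\frac k2\mathbb{N}$. No $k$-graph in the family $\mathcal{H}_{\mathrm{ext}}(n,k)$ contains a Hamilton $(k/2)$-cycle.
   Context: A $k$-graph has vertex set $V$ and edge set $E\subseteq\binom{V}{k}$. For $1\le \ell<k$, an $\ell$-cycle is a $k$-graph whose vertices can be ordered cyclically so that each edge consists of $k$ consecutive vertices and consecutive edges share exactly $\ell$ vertices; a Hamilton $\ell$-cycle is a spanning $\ell$-cycle. Given an $n$-element vertex set $V$ with a partition $V=A\,\dot\cup\, B$, a set $S\subseteq V$ is odd (resp. even) if $|S\cap A|$ is odd (resp. even). $\mathcal{B}_{n,k}(A,B)$ is the $k$-graph on $V$ whose edges are all odd $k$-subsets of $V$, and $\overline{\mathcal{B}}_{n,k}(A,B)$ is the $k$-graph on $V$ whose edges are all even $k$-subsets of $V$. A star $\mathcal{S}_{m,k}$ on an $m$-set consists of all $k$-subsets containing a fixed vertex. $\mathcal{B}'_{n,k}(A,B)$ is obtained from $\mathcal{B}_{n,k}(A,B)$ by adding a star $\mathcal{S}_{|A|,k}$ on the vertex set $A$ (all $k$-subsets of $A$ containing a fixed vertex of $A$). The family $\mathcal{H}_{\mathrm{ext}}(n,k)$ (over all partitions $V=A\cup B$) is: if $n\in k\mathbb{N}$, all $\mathcal{B}_{n,k}(A,B)$ with $n/k-|A|$ odd and all $\overline{\mathcal{B}}_{n,k}(A,B)$ with $|A|$ odd; if $n\in\frac k2\mathbb{N}\setminus k\mathbb{N}$, all $\mathcal{B}_{n,k}(A,B)$,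 together with all $\mathcal{B}'_{n,k}(A,B)$ with $\lfloor n/k\rfloor-|A|$ odd when $k\in 4\mathbb{N}$, and all $\mathcal{B}'_{n,k}(A,B)$ with $\lfloor n/k\rfloor-|A|$ even when $k\in 2\mathbb{N}\setminus 4\mathbb{N}$. -}

module Defs where

open import Data.Nat using (ℕ; zero; suc; _+_; _*_; _∸_; _<_; NonZero)
open import Data.Nat.DivMod using (_mod_; _/_; _%_)
open import Data.Nat.Divisibility using (_∣_)
open import Data.Fin using (Fin)
open import Data.Fin.Subset using (Subset; ⁅_⁆; _∩_; _∪_; ⋃; ∣_∣; _∈_)
open import Data.List using (List; map; upTo)
open import Data.Product using (_×_; Σ)
open import Data.Sum using (_⊎_)
open import Function.Bundles using (_↔_; Inverse)
open import Relation.Binary.PropositionalEquality using (_≡_)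
open import Relation.Nullary using (¬_)

-- A k-graph is one all of whose edges have size k;
-- all concrete hypergraphs below include the size condition ∣ S ∣ ≡ k.
HGraph : ℕ → Set₁
HGraph n = Subset n → Set

Odd : ℕ → Set
Odd m = m % 2 ≡ 1

Even : ℕ → Set
Even m = m % 2 ≡ 0

-- S is odd (w.r.t. the partition A, B = complement of A) iff |S ∩ A| odd
OddSet : ∀ {n} → Subset n → Subset n → Set
OddSet A S = Odd ∣ S ∩ A ∣

EvenSet : ∀ {n} → Subset n → Subset n → Set
EvenSet A S = Even ∣ S ∩ A ∣

_⊆ₛ_ : ∀ {n} → Subset n → Subset n → Set
S ⊆ₛ A = ∀ {x} → x ∈ S → x ∈ A

𝓑 : ∀ {n} → ℕ → Subset n → HGraph n
𝓑 k A S = (∣ S ∣ ≡ k) × OddSet A S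

𝓑bar : ∀ {n} → ℕ → Subset n → HGraph n
𝓑bar k A S = (∣ S ∣ ≡ k) × EvenSet A S

Star : ∀ {n} → ℕ → Subset n → Fin n → HGraph n
Star k A a S = (∣ S ∣ ≡ k) × (S ⊆ₛ A) × (a ∈ S)

𝓑′ : ∀ {n} → ℕ → Subset n → Fin n → HGraph n
𝓑′ k A a S = 𝓑 k A S ⊎ Star k A a S

-- membership in the family H_ext(n,k)  (B = complement of A).
-- "n/k - |A| odd" is a statement about an integer difference; its parity
-- equals the parity of n/k + |A|, which we use to avoid truncated subtraction.
data Hext (n k : ℕ) .{{_ : NonZero k}} : HGraph n → Set₁ where
  ext-B : (A : Subset n) → k ∣ n → Odd (n / k + ∣ A ∣) → Hext n k (𝓑 k A)
  ext-Bbar : (A : Subset n) → k ∣ n → Odd ∣ A ∣ → Hext n k (𝓑bar k A)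
  ext-B-half : (A : Subset n) → (k / 2) ∣ n → ¬ (k ∣ n) → Hext n k (𝓑 k A)
  ext-B′-4 : (A : Subset n) (a : Fin n) → a ∈ A → (k / 2) ∣ n → ¬ (k ∣ n) →
             4 ∣ k → Odd (n / k + ∣ A ∣) → Hext n k (𝓑′ k A a)
  ext-B′-2 : (A : Subset n) (a : Fin n) → a ∈ A → (k / 2) ∣ n → ¬ (k ∣ n) →
             2 ∣ k → ¬ (4 ∣ k) → Even (n / k + ∣ A ∣) → Hext n k (𝓑′ k A a)

segment : ∀ {n} .{{_ : NonZero n}} → (Fin n → Fin n) → ℕ → ℕ → Subset n
segment {n} σ k s = ⋃ (map (λ j → ⁅ σ ((s + j) mod n) ⁆) (upTo k))

-- H (a hypergraph on Fin n) contains a Hamilton ℓ-cycle of uniformity k: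
-- a cyclic ordering σ of all vertices and t edges E_0,…,E_{t-1}, where
-- E_i consists of the k consecutive vertices starting at position i(k-ℓ),
-- t(k-ℓ) = n (so the cycle is spanning), each E_i is a k-set and an edge
-- of H, and consecutive edges E_i, E_{i+1} (indices mod t) share exactly
-- ℓ vertices.
record HamiltonCycle (k ℓ n : ℕ) (H : HGraph n) : Set where
  field
    {{nonZero}} : NonZero n
    order    : Fin n ↔ Fin n
    t        : ℕ
    spanning : t * (k ∸ ℓ) ≡ n
  σ : Fin n → Fin n
  σ = Inverse.to order
  E : ℕ → Subset n
  E i = segment σ k (i * (k ∸ ℓ))
  field
    edge-size : ∀ i → i < t → ∣ E i ∣ ≡ k
    edge-in-H : ∀ i → i < t → H (E i)
    intersect : ∀ i → i < t → ∣ E i ∩ E (suc i) ∣ ≡ ℓ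

module Submission where

-- Write k = 2h.  A Hamilton h-cycle of uniformity 2h cuts its cyclic vertex
-- order into t = n / h blocks of h consecutive vertices, and edge i is the
-- union of blocks i and i + 1 (indices mod t).  For a vertex class A let b i be
-- the number of vertices of A in block i; then |edge i ∩ A| = b i + b (i + 1)
-- and |A| = ∑ b i, and the whole proof is parity bookkeeping on the t-periodic
-- sequence b, done in the two-element field Data.Parity:
--   * double counting: ∑ |edge i ∩ A| = 2|A|, so if all edges are odd, t is even;
--   * if t = 2u, the edges 0, 2, …, 2u - 2 partition V, so |A| ≡ u · (edge parity);
--   * in B′ with t = 2w + 1, some edge is a star edge, the block c of its centre
--     is full, and the 2w blocks after c pair up into w odd edges, so |A| ≡ w + h.
-- Together with n / k = ⌊t/2⌋ and "k ∣ n iff t is even" this refutes each of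
-- the five members of H_ext(n, k).

open import Defs
open import Data.Bool using (true; false)
open import Data.Empty using (⊥-elim)
open import Data.Fin using (Fin; toℕ)
open import Data.Fin.Properties using (toℕ-injective; toℕ-fromℕ<; toℕ<n)
open import Data.Fin.Subset using (Subset; ⁅_⁆; _∩_; _∪_; ⋃; ∣_∣; _∈_; _∉_) renaming (⊥ to ∅)
open import Data.Fin.Subset.Properties
  using (⊆-antisym; p∩q⊆p; p∩q⊆q; x∈p∩q⁺; x∈p∩q⁻; ∩-distribʳ-∪; ∩-zeroˡ; x∈⁅y⁆⇒x≡y; x∈⁅x⁆;
         ∉⊥; x∈p∪q⁻; x∈p∪q⁺; ∣p∩q∣≤∣p∣; ∣⁅x⁆∣≡1; ∣⊥∣≡0; ∣p∣≤n)
open import Data.List using (applyUpTo; upTo)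
open import Data.List.Properties using (map-upTo; map-cong)
open import Data.Nat
  using (ℕ; zero; suc; _+_; _*_; _∸_; _≤_; _<_; _>_; z≤n; s≤s; _/_; _%_; NonZero;
         ≢-nonZero; ≢-nonZero⁻¹; >-nonZero⁻¹; parity)
open import Data.Nat.DivMod
open import Data.Nat.Divisibility
  using (_∣_; divides; ∣-refl; ∣m∣n⇒∣m+n; *-cancelˡ-∣; *-cancelʳ-∣; *-monoʳ-∣; *-monoˡ-∣; ∣⇒≤)
open import Data.Nat.Properties
open import Algebra.Properties.CommutativeSemigroup +-commutativeSemigroup
  using () renaming (interchange to +-interchange; xy∙z≈xz∙y to +-right-comm)
open import Data.Nat.Tactic.RingSolver using (solve-∀)
open import Data.Parity.Base as ℙ using (0ℙ; 1ℙ)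
import Data.Parity.Properties as ℙ
open import Data.Product using (_×_; _,_; ∃; proj₁; proj₂)
open import Data.Sum using (_⊎_; inj₁; inj₂)
open import Data.Vec using ([]; _∷_; here; there)
open import Function using (_∘_)
open import Function.Bundles using (_↔_; Inverse)
open import Relation.Binary.Definitions using (Tri; tri<; tri≈; tri>)
open import Relation.Binary.PropositionalEquality
open import Relation.Nullary using (¬_; yes; no; contradiction)

-- Parity of natural numbers

-- parity is a semiring homomorphism ℕ → Data.Parity, so 2u is even and 2u + 1 odd.
parity-double : ∀ u → parity (u * 2) ≡ 0ℙ
parity-double u = trans (ℙ.*-homo-* u 2) (ℙ.*-zeroʳ (parity u))

parity-1+double : ∀ u → parity (suc (u * 2)) ≡ 1ℙ
parity-1+double u = trans (ℙ.+-homo-+ 1 (u * 2)) (cong (1ℙ ℙ.+_) (parity-double u))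

parity-%2 : ∀ m → parity (m % 2) ≡ parity m
parity-%2 m = sym (begin
  parity m                               ≡⟨ cong parity (m≡m%n+[m/n]*n m 2) ⟩
  parity (m % 2 + m / 2 * 2)             ≡⟨ ℙ.+-homo-+ (m % 2) _ ⟩
  parity (m % 2) ℙ.+ parity (m / 2 * 2)  ≡⟨ cong (parity (m % 2) ℙ.+_) (parity-double (m / 2)) ⟩
  parity (m % 2) ℙ.+ 0ℙ                  ≡⟨ ℙ.+-identityʳ _ ⟩
  parity (m % 2)                         ∎)
  where open ≡-Reasoning

odd⇒parity≡1ℙ : ∀ m → Odd m → parity m ≡ 1ℙ
odd⇒parity≡1ℙ m odd = trans (sym (parity-%2 m)) (cong parity odd)

even⇒parity≡0ℙ : ∀ m → Even m → parity m ≡ 0ℙ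
even⇒parity≡0ℙ m even = trans (sym (parity-%2 m)) (cong parity even)

parity≡0ℙ⇒2∣ : ∀ m → parity m ≡ 0ℙ → 2 ∣ m
parity≡0ℙ⇒2∣ zero          _ = divides 0 refl
parity≡0ℙ⇒2∣ (suc zero)    ()
parity≡0ℙ⇒2∣ (suc (suc m)) p = ∣m∣n⇒∣m+n (∣-refl {2}) (parity≡0ℙ⇒2∣ m p)

2∣⇒parity≡0ℙ : ∀ {m} → 2 ∣ m → parity m ≡ 0ℙ
2∣⇒parity≡0ℙ (divides u refl) = parity-double u

parity≡1ℙ⇒odd-form : ∀ m → parity m ≡ 1ℙ → m ≡ suc (m / 2 * 2)
parity≡1ℙ⇒odd-form m p with m % 2 | m%n<n m 2 | parity-%2 m | m≡m%n+[m/n]*n m 2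
... | 0           | _                | p0 | _ = contradiction (trans p0 p) λ ()
... | 1           | _                | _  | m≡ = m≡
... | suc (suc _) | s≤s (s≤s ())     | _  | _

¬2∣⇒parity≡1ℙ : ∀ m → ¬ 2 ∣ m → parity m ≡ 1ℙ
¬2∣⇒parity≡1ℙ m 2∤m with parity m in eq
... | 1ℙ = refl
... | 0ℙ = contradiction (parity≡0ℙ⇒2∣ m eq) 2∤m

4∣2h⇒parity≡0ℙ : ∀ h → 4 ∣ 2 * h → parity h ≡ 0ℙ
4∣2h⇒parity≡0ℙ h 4∣2h = 2∣⇒parity≡0ℙ {h} (*-cancelˡ-∣ 2 4∣2h)

4∤2h⇒parity≡1ℙ : ∀ h → ¬ 4 ∣ 2 * h → parity h ≡ 1ℙ
4∤2h⇒parity≡1ℙ h 4∤2h = ¬2∣⇒parity≡1ℙ h (λ 2∣h → 4∤2h (*-monoʳ-∣ 2 2∣h))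

-- Finite sums  ∑[ i < m ] f i = f 0 + … + f (m - 1)

∑< : ℕ → (ℕ → ℕ) → ℕ
∑< zero    f = 0
∑< (suc m) f = f 0 + ∑< m (λ i → f (suc i))

syntax ∑< m (λ i → e) = ∑[ i < m ] e

∑-cong : ∀ m {f g : ℕ → ℕ} → (∀ i → f i ≡ g i) → ∑< m f ≡ ∑< m g
∑-cong zero    f≗g = refl
∑-cong (suc m) f≗g = cong₂ _+_ (f≗g 0) (∑-cong m (λ i → f≗g (suc i)))

∑-+ : ∀ m (f g : ℕ → ℕ) → ∑[ i < m ] (f i + g i) ≡ ∑< m f + ∑< m g
∑-+ zero    f g = refl
∑-+ (suc m) f g =
  trans (cong (f 0 + g 0 +_) (∑-+ m (λ i → f (suc i)) (λ i → g (suc i))))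
        (+-interchange (f 0) (g 0) _ _)

∑-split : ∀ a b (f : ℕ → ℕ) → ∑< (a + b) f ≡ ∑< a f + ∑[ j < b ] f (a + j)
∑-split zero    b f = refl
∑-split (suc a) b f =
  trans (cong (f 0 +_) (∑-split a b (λ i → f (suc i)))) (sym (+-assoc (f 0) _ _))

∑-last : ∀ m (f : ℕ → ℕ) → ∑< (suc m) f ≡ ∑< m f + f m
∑-last m f = begin
  ∑< (suc m) f          ≡⟨ cong (λ l → ∑< l f) (+-comm 1 m) ⟩
  ∑< (m + 1) f          ≡⟨ ∑-split m 1 f ⟩
  ∑< m f + (f (m + 0) + 0) ≡⟨ cong (∑< m f +_) (trans (+-identityʳ _) (cong f (+-identityʳ m))) ⟩
  ∑< m f + f m          ∎
  where open ≡-Reasoning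

∑-blocks : ∀ t h (f : ℕ → ℕ) → ∑< (t * h) f ≡ ∑[ i < t ] ∑[ j < h ] f (i * h + j)
∑-blocks zero    h f = refl
∑-blocks (suc t) h f = trans (∑-split h (t * h) f) (cong (∑< h f +_) (begin
  ∑[ p < t * h ] f (h + p)                         ≡⟨ ∑-blocks t h (λ p → f (h + p)) ⟩
  ∑[ i < t ] ∑[ j < h ] f (h + (i * h + j))        ≡⟨ ∑-cong t (λ i → ∑-cong h (λ j → cong f (sym (+-assoc h (i * h) j)))) ⟩
  ∑[ i < t ] ∑[ j < h ] f (suc i * h + j)          ∎))
  where open ≡-Reasoning

∑-pairs : ∀ u (f : ℕ → ℕ) → ∑< (u * 2) f ≡ ∑[ v < u ] (f (v * 2) + f (suc (v * 2)))
∑-pairs u f = trans (∑-blocks u 2 f) (∑-cong u λ v →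
  cong₂ _+_ (cong f (+-identityʳ (v * 2))) (trans (+-identityʳ _) (cong f (+-comm (v * 2) 1))))

∑-bound : ∀ m (f : ℕ → ℕ) → (∀ i → f i ≤ 1) → ∑< m f ≤ m
∑-bound zero    f f≤1 = z≤n
∑-bound (suc m) f f≤1 = +-mono-≤ (f≤1 0) (∑-bound m (λ i → f (suc i)) (λ i → f≤1 (suc i)))

∑-rotate : ∀ t (f : ℕ → ℕ) → (∀ i → f (t + i) ≡ f i) → ∀ s → ∑[ i < t ] f (s + i) ≡ ∑< t f
∑-rotate t f periodic zero    = refl
∑-rotate t f periodic (suc s) = begin
  ∑[ i < t ] f (suc s + i)      ≡⟨ ∑-cong t (λ i → cong f (sym (+-suc s i))) ⟩
  ∑[ i < t ] g (suc i)          ≡⟨ +-cancelˡ-≡ (g 0) _ _ shift ⟩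
  ∑< t g                        ≡⟨ ∑-rotate t f periodic s ⟩
  ∑< t f                        ∎
  where
  open ≡-Reasoning
  g : ℕ → ℕ
  g i = f (s + i)
  g-periodic : g t ≡ g 0
  g-periodic = trans (cong f (+-comm s t)) (trans (periodic s) (cong f (sym (+-identityʳ s))))
  shift : g 0 + ∑[ i < t ] g (suc i) ≡ g 0 + ∑< t g
  shift = trans (∑-last t g) (trans (cong (∑< t g +_) g-periodic) (+-comm (∑< t g) (g 0)))

parity-∑ : ∀ m (f : ℕ → ℕ) {p} → (∀ i → i < m → parity (f i) ≡ p) → parity (∑< m f) ≡ parity m ℙ.* p
parity-∑ zero    f _ = refl
parity-∑ (suc m) f {p} fp = begin
  parity (f 0 + ∑[ i < m ] f (suc i))          ≡⟨ ℙ.+-homo-+ (f 0) _ ⟩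
  parity (f 0) ℙ.+ parity (∑[ i < m ] f (suc i)) ≡⟨ cong₂ ℙ._+_ (fp 0 (s≤s z≤n)) (parity-∑ m _ (λ i i<m → fp (suc i) (s≤s i<m))) ⟩
  p ℙ.+ (parity m ℙ.* p)                       ≡⟨ sym (ℙ.*-distribʳ-+ p 1ℙ (parity m)) ⟩
  (1ℙ ℙ.+ parity m) ℙ.* p                      ≡⟨ cong (ℙ._* p) (sym (ℙ.+-homo-+ 1 m)) ⟩
  parity (suc m) ℙ.* p                         ∎
  where open ≡-Reasoning

all-or-exception : ∀ m {P Q : ℕ → Set} → (∀ i → i < m → P i ⊎ Q i) →
                   (∀ i → i < m → P i) ⊎ ∃ λ i → i < m × Q i
all-or-exception zero    _    = inj₁ λ _ ()
all-or-exception (suc m) {P} pq with pq 0 (s≤s z≤n) | all-or-exception m (λ i i<m → pq (suc i) (s≤s i<m))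
... | inj₂ q0 | _                 = inj₂ (0 , s≤s z≤n , q0)
... | inj₁ _  | inj₂ (i , i<m , q) = inj₂ (suc i , s≤s i<m , q)
... | inj₁ p0 | inj₁ ps           = inj₁ all
  where
  all : ∀ i → i < suc m → P i
  all zero    _         = p0
  all (suc i) (s≤s i<m) = ps i i<m

-- Cardinalities of subsets of Fin n

∣∪∣-disjoint : ∀ {n} (p q : Subset n) → (∀ {x} → x ∈ p → x ∉ q) → ∣ p ∪ q ∣ ≡ ∣ p ∣ + ∣ q ∣
∣∪∣-disjoint []          []          _ = refl
∣∪∣-disjoint (true ∷ p)  (true ∷ q)  d = ⊥-elim (d here here)
∣∪∣-disjoint (true ∷ p)  (false ∷ q) d = cong suc (∣∪∣-disjoint p q (λ x∈p x∈q → d (there x∈p) (there x∈q)))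
∣∪∣-disjoint (false ∷ p) (true ∷ q)  d =
  trans (cong suc (∣∪∣-disjoint p q (λ x∈p x∈q → d (there x∈p) (there x∈q)))) (sym (+-suc ∣ p ∣ ∣ q ∣))
∣∪∣-disjoint (false ∷ p) (false ∷ q) d = ∣∪∣-disjoint p q (λ x∈p x∈q → d (there x∈p) (there x∈q))

∣⁅x⁆∪S∩A∣ : ∀ {n} (x : Fin n) (S A : Subset n) → x ∉ S → ∣ (⁅ x ⁆ ∪ S) ∩ A ∣ ≡ ∣ ⁅ x ⁆ ∩ A ∣ + ∣ S ∩ A ∣
∣⁅x⁆∪S∩A∣ x S A x∉S = trans (cong ∣_∣ (∩-distribʳ-∪ A ⁅ x ⁆ S)) (∣∪∣-disjoint (⁅ x ⁆ ∩ A) (S ∩ A) disjoint)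
  where
  disjoint : ∀ {y} → y ∈ ⁅ x ⁆ ∩ A → y ∉ S ∩ A
  disjoint y∈x y∈S = x∉S (subst (_∈ S) (x∈⁅y⁆⇒x≡y x (proj₁ (x∈p∩q⁻ _ A y∈x))) (proj₁ (x∈p∩q⁻ S A y∈S)))

∣⁅x⁆∩A∣≤1 : ∀ {n} (x : Fin n) (A : Subset n) → ∣ ⁅ x ⁆ ∩ A ∣ ≤ 1
∣⁅x⁆∩A∣≤1 x A = subst (∣ ⁅ x ⁆ ∩ A ∣ ≤_) (∣⁅x⁆∣≡1 x) (∣p∩q∣≤∣p∣ ⁅ x ⁆ A)

values : ∀ {n} → (ℕ → Fin n) → ℕ → Subset n
values g m = ⋃ (applyUpTo (λ j → ⁅ g j ⁆) m)

∈values⁻ : ∀ {n} (g : ℕ → Fin n) m {x} → x ∈ values g m → ∃ λ j → j < m × g j ≡ x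
∈values⁻ g zero    x∈ = ⊥-elim (∉⊥ x∈)
∈values⁻ g (suc m) x∈ with x∈p∪q⁻ ⁅ g 0 ⁆ (values (λ j → g (suc j)) m) x∈
... | inj₁ x∈g0 = 0 , s≤s z≤n , sym (x∈⁅y⁆⇒x≡y (g 0) x∈g0)
... | inj₂ x∈gs with ∈values⁻ (λ j → g (suc j)) m x∈gs
...   | j , j<m , gj≡x = suc j , s≤s j<m , gj≡x

∈values⁺ : ∀ {n} (g : ℕ → Fin n) {m} j → j < m → g j ∈ values g m
∈values⁺ g zero    (s≤s _)   = x∈p∪q⁺ (inj₁ (x∈⁅x⁆ (g 0)))
∈values⁺ g (suc j) (s≤s j<m) = x∈p∪q⁺ (inj₂ (∈values⁺ (λ i → g (suc i)) j j<m))

∣values∩A∣ : ∀ {n} (g : ℕ → Fin n) m (A : Subset n) →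
             (∀ {i j} → i < m → j < m → g i ≡ g j → i ≡ j) →
             ∣ values g m ∩ A ∣ ≡ ∑[ j < m ] ∣ ⁅ g j ⁆ ∩ A ∣
∣values∩A∣ g zero    A _   = ∣∅∩A∣ A
  where
  ∣∅∩A∣ : ∀ {n} (A : Subset n) → ∣ ∅ ∩ A ∣ ≡ 0
  ∣∅∩A∣ {n} A = trans (cong ∣_∣ (∩-zeroˡ A)) (∣⊥∣≡0 n)
∣values∩A∣ g (suc m) A inj =
  trans (∣⁅x⁆∪S∩A∣ (g 0) (values g′ m) A g0∉) (cong (∣ ⁅ g 0 ⁆ ∩ A ∣ +_) (∣values∩A∣ g′ m A inj′))
  where
  g′ : ℕ → _
  g′ j = g (suc j)
  inj′ : ∀ {i j} → i < m → j < m → g′ i ≡ g′ j → i ≡ j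
  inj′ i<m j<m e = suc-injective (inj (s≤s i<m) (s≤s j<m) e)
  g0∉ : g 0 ∉ values g′ m
  g0∉ g0∈ with ∈values⁻ g′ m g0∈
  ... | j , j<m , e with inj (s≤s j<m) (s≤s z≤n) e
  ... | ()

both-maximal : ∀ {x y h} → x ≤ h → y ≤ h → x + y ≡ h + h → x ≡ h × y ≡ h
both-maximal {x} {y} {h} x≤h y≤h x+y≡2h =
  ≤-antisym x≤h (+-cancelʳ-≤ h h x (subst (_≤ x + h) x+y≡2h (+-monoʳ-≤ x y≤h))) ,
  ≤-antisym y≤h (+-cancelˡ-≤ h h y (subst (_≤ h + y) x+y≡2h (+-monoˡ-≤ y x≤h)))

residues-distinct : ∀ {n} .{{_ : NonZero n}} x {d} → 0 < d → d < n → (x + d) % n ≢ x % n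
residues-distinct {n} x {d@(suc _)} _ d<n same = <⇒≱ d<n (∣⇒≤ n∣d)
  where
  a = (x + d) / n
  b = x / n
  r = x % n
  d+bn≡an : d + b * n ≡ a * n
  d+bn≡an = +-cancelˡ-≡ r _ _ (begin
    r + (d + b * n)   ≡⟨ cong (r +_) (+-comm d (b * n)) ⟩
    r + (b * n + d)   ≡⟨ sym (+-assoc r (b * n) d) ⟩
    r + b * n + d     ≡⟨ cong (_+ d) (sym (m≡m%n+[m/n]*n x n)) ⟩
    x + d             ≡⟨ m≡m%n+[m/n]*n (x + d) n ⟩
    (x + d) % n + a * n ≡⟨ cong (_+ a * n) same ⟩
    r + a * n         ∎)
    where open ≡-Reasoning
  n∣d : n ∣ d
  n∣d = divides (a ∸ b) (begin
    d                 ≡⟨ sym (m+n∸n≡m d (b * n)) ⟩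
    d + b * n ∸ b * n ≡⟨ cong (_∸ b * n) d+bn≡an ⟩
    a * n ∸ b * n     ≡⟨ sym (*-distribʳ-∸ n a b) ⟩
    (a ∸ b) * n       ∎)
    where open ≡-Reasoning

module CyclicOrder {n : ℕ} .{{_ : NonZero n}} (order : Fin n ↔ Fin n) where

  σ : Fin n → Fin n
  σ = Inverse.to order

  vertexAt : ℕ → Fin n
  vertexAt p = σ (p mod n)

  σ-injective : ∀ {x y} → σ x ≡ σ y → x ≡ y
  σ-injective {x} {y} e = begin
    x                         ≡⟨ sym (Inverse.strictlyInverseʳ order x) ⟩
    Inverse.from order (σ x)  ≡⟨ cong (Inverse.from order) e ⟩
    Inverse.from order (σ y)  ≡⟨ Inverse.strictlyInverseʳ order y ⟩
    y                         ∎
    where open ≡-Reasoning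

  vertexAt-periodic : ∀ p c → vertexAt (p + c * n) ≡ vertexAt p
  vertexAt-periodic p c =
    cong σ (toℕ-injective (trans (toℕ-fromℕ< _) (trans ([m+kn]%n≡m%n p c n) (sym (toℕ-fromℕ< _)))))

  vertexAt-injective : ∀ s {i j} → i < n → j < n → vertexAt (s + i) ≡ vertexAt (s + j) → i ≡ j
  vertexAt-injective s {i} {j} i<n j<n e = by-comparison (<-cmp i j)
    where
    same-residue : (s + i) % n ≡ (s + j) % n
    same-residue = trans (sym (toℕ-fromℕ< _)) (trans (cong toℕ (σ-injective e)) (toℕ-fromℕ< _))
    apart : ∀ {a b} → a < b → b < n → (s + b) % n ≢ (s + a) % n
    apart {a} {b} a<b b<n = subst (λ x → x % n ≢ (s + a) % n) shifted
      (residues-distinct (s + a) (m<n⇒0<n∸m a<b) (≤-<-trans (m∸n≤m b a) b<n))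
      where
      shifted : s + a + (b ∸ a) ≡ s + b
      shifted = trans (+-assoc s a _) (cong (s +_) (m+[n∸m]≡n (<⇒≤ a<b)))
    by-comparison : Tri (i < j) (i ≡ j) (i > j) → i ≡ j
    by-comparison (tri< i<j _ _) = ⊥-elim (apart i<j j<n (sym same-residue))
    by-comparison (tri≈ _ i≡j _) = i≡j
    by-comparison (tri> _ _ j<i) = ⊥-elim (apart j<i i<n same-residue)

  vertexAt-surjective : ∀ x → ∃ λ p → p < n × vertexAt p ≡ x
  vertexAt-surjective x = toℕ y , toℕ<n y , trans (cong σ (toℕ-injective (trans (toℕ-fromℕ< _) (m<n⇒m%n≡m (toℕ<n y)))))
                                                 (Inverse.strictlyInverseˡ order x)
    where y = Inverse.from order x

  segment-values : ∀ m s → segment σ m s ≡ values (λ j → vertexAt (s + j)) m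
  segment-values m s = cong ⋃ (map-upTo (λ j → ⁅ vertexAt (s + j) ⁆) m)

  ∈segment⁻ : ∀ {m s x} → x ∈ segment σ m s → ∃ λ j → j < m × vertexAt (s + j) ≡ x
  ∈segment⁻ {m} {s} x∈ = ∈values⁻ _ m (subst (_ ∈_) (segment-values m s) x∈)

  segment-periodic : ∀ m s c → segment σ m (s + c * n) ≡ segment σ m s
  segment-periodic m s c = cong ⋃ (map-cong (λ j → cong ⁅_⁆ (shift j)) (upTo m))
    where
    shift : ∀ j → vertexAt (s + c * n + j) ≡ vertexAt (s + j)
    shift j = trans (cong vertexAt (+-right-comm s (c * n) j)) (vertexAt-periodic (s + j) c)

  ∣segment∩A∣ : ∀ {m} → m ≤ n → ∀ s (A : Subset n) →
                ∣ segment σ m s ∩ A ∣ ≡ ∑[ j < m ] ∣ ⁅ vertexAt (s + j) ⁆ ∩ A ∣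
  ∣segment∩A∣ {m} m≤n s A = trans (cong (λ S → ∣ S ∩ A ∣) (segment-values m s))
    (∣values∩A∣ _ m A (λ i<m j<m → vertexAt-injective s (<-≤-trans i<m m≤n) (<-≤-trans j<m m≤n)))

  ∣A∣-by-positions : ∀ (A : Subset n) → ∣ A ∣ ≡ ∑[ p < n ] ∣ ⁅ vertexAt p ⁆ ∩ A ∣
  ∣A∣-by-positions A = trans (cong ∣_∣ (sym turn∩A≡A)) (∣segment∩A∣ ≤-refl 0 A)
    where
    in-turn : ∀ x → x ∈ segment σ n 0
    in-turn x with vertexAt-surjective x
    ... | p , p<n , vp≡x = subst (_∈ segment σ n 0) vp≡x
                             (subst (vertexAt p ∈_) (sym (segment-values n 0)) (∈values⁺ vertexAt p p<n))
    turn∩A≡A : segment σ n 0 ∩ A ≡ A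
    turn∩A≡A = ⊆-antisym (p∩q⊆q _ A) (λ x∈A → x∈p∩q⁺ (in-turn _ , x∈A))

-- Cutting the cyclic order into
-- t blocks of h consecutive vertices, edge i is the union of blocks i and
-- i + 1, so everything is governed by the numbers blockCount i of vertices
-- of A in block i.
module HalfOverlapCycle {n : ℕ} {H : HGraph n} {k h : ℕ} (k≡2h : k ≡ 2 * h)
                        (cycle : HamiltonCycle k h n H) (A : Subset n) where

  open HamiltonCycle cycle
  open CyclicOrder order hiding (σ)

  k≡h+h : k ≡ h + h
  k≡h+h = trans k≡2h (cong (h +_) (+-identityʳ h))

  t*h≡n : t * h ≡ n
  t*h≡n = trans (cong (t *_) (sym (trans (cong (_∸ h) k≡h+h) (m+n∸n≡m h h)))) spanning

  instance
    t-nonZero : NonZero t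
    t-nonZero = ≢-nonZero λ t≡0 → ≢-nonZero⁻¹ n (trans (sym t*h≡n) (cong (_* h) t≡0))

    h-nonZero : NonZero h
    h-nonZero = ≢-nonZero λ h≡0 → ≢-nonZero⁻¹ n (trans (sym t*h≡n) (trans (cong (t *_) h≡0) (*-zeroʳ t)))

  edge : ℕ → Subset n
  edge i = segment σ (h + h) (i * h)

  E≡edge : ∀ i → E i ≡ edge i
  E≡edge i = cong₂ (λ m d → segment σ m (i * d)) k≡h+h (trans (cong (_∸ h) k≡h+h) (m+n∸n≡m h h))

  -- Edge indices are taken modulo t, so every edge i is an edge of H.
  every-edge : ∀ i → H (edge i)
  every-edge i = subst H (trans (E≡edge (i % t)) (sym edge≡)) (edge-in-H (i % t) (m%n<n i t))
    where
    edge≡ : edge i ≡ edge (i % t)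
    edge≡ = begin
      segment σ (h + h) (i * h)                          ≡⟨ cong (λ x → segment σ (h + h) (x * h)) (m≡m%n+[m/n]*n i t) ⟩
      segment σ (h + h) ((i % t + i / t * t) * h)        ≡⟨ cong (segment σ (h + h)) (positions (i % t) (i / t)) ⟩
      segment σ (h + h) (i % t * h + i / t * n)          ≡⟨ segment-periodic (h + h) (i % t * h) (i / t) ⟩
      segment σ (h + h) (i % t * h)                      ∎
      where
      open ≡-Reasoning
      positions : ∀ r c → (r + c * t) * h ≡ r * h + c * n
      positions r c = trans (*-distribʳ-+ h r (c * t))
                            (cong (r * h +_) (trans (*-assoc c t h) (cong (c *_) t*h≡n)))

  -- An edge has 2h ≤ n vertices, so its positions are pairwise distinct.
  h+h≤n : h + h ≤ n
  h+h≤n = subst (_≤ n) (trans (edge-size 0 (>-nonZero⁻¹ t)) k≡h+h) (∣p∣≤n (E 0))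

  inA : ℕ → ℕ
  inA p = ∣ ⁅ vertexAt p ⁆ ∩ A ∣

  blockCount : ℕ → ℕ
  blockCount i = ∑[ j < h ] inA (i * h + j)

  blockCount≤h : ∀ i → blockCount i ≤ h
  blockCount≤h i = ∑-bound h _ (λ j → ∣⁅x⁆∩A∣≤1 (vertexAt (i * h + j)) A)

  blockCount-periodic : ∀ i → blockCount (t + i) ≡ blockCount i
  blockCount-periodic i = ∑-cong h λ j → begin
    inA ((t + i) * h + j)        ≡⟨ cong inA (shift j) ⟩
    inA (i * h + j + 1 * n)      ≡⟨ cong (λ x → ∣ ⁅ x ⁆ ∩ A ∣) (vertexAt-periodic (i * h + j) 1) ⟩
    inA (i * h + j)              ∎
    where
    open ≡-Reasoning
    shift : ∀ j → (t + i) * h + j ≡ i * h + j + 1 * n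
    shift j = begin
      (t + i) * h + j            ≡⟨ cong (_+ j) (trans (*-distribʳ-+ h t i) (+-comm (t * h) (i * h))) ⟩
      i * h + t * h + j          ≡⟨ +-right-comm (i * h) (t * h) j ⟩
      i * h + j + t * h          ≡⟨ cong (i * h + j +_) (trans t*h≡n (sym (+-identityʳ n))) ⟩
      i * h + j + 1 * n          ∎

  ∣edge∩A∣ : ∀ i → ∣ edge i ∩ A ∣ ≡ blockCount i + blockCount (suc i)
  ∣edge∩A∣ i = begin
    ∣ edge i ∩ A ∣                              ≡⟨ ∣segment∩A∣ h+h≤n (i * h) A ⟩
    ∑[ j < h + h ] inA (i * h + j)              ≡⟨ ∑-split h h _ ⟩
    blockCount i + ∑[ j < h ] inA (i * h + (h + j)) ≡⟨ cong (blockCount i +_) (∑-cong h λ j → cong inA (next j)) ⟩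
    blockCount i + blockCount (suc i)           ∎
    where
    open ≡-Reasoning
    next : ∀ j → i * h + (h + j) ≡ suc i * h + j
    next j = trans (sym (+-assoc (i * h) h j)) (cong (_+ j) (+-comm (i * h) h))

  ∣A∣-by-blocks : ∀ s → ∣ A ∣ ≡ ∑[ i < t ] blockCount (s + i)
  ∣A∣-by-blocks s = begin
    ∣ A ∣                             ≡⟨ ∣A∣-by-positions A ⟩
    ∑[ p < n ] inA p                  ≡⟨ cong (λ m → ∑< m inA) (sym t*h≡n) ⟩
    ∑[ p < t * h ] inA p              ≡⟨ ∑-blocks t h inA ⟩
    ∑[ i < t ] blockCount i           ≡⟨ sym (∑-rotate t blockCount blockCount-periodic s) ⟩
    ∑[ i < t ] blockCount (s + i)     ∎
    where open ≡-Reasoning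

  -- Double counting: the t edges cover every vertex twice, so ∑ |edge i ∩ A| = 2|A|;
  -- hence if every edge meets A in an odd number of vertices, t is even.
  all-odd⇒t-even : (∀ i → i < t → parity ∣ edge i ∩ A ∣ ≡ 1ℙ) → parity t ≡ 0ℙ
  all-odd⇒t-even odd = begin
    parity t                                               ≡⟨ sym (ℙ.*-identityʳ (parity t)) ⟩
    parity t ℙ.* 1ℙ                                        ≡⟨ sym (parity-∑ t _ odd) ⟩
    parity (∑[ i < t ] ∣ edge i ∩ A ∣)                     ≡⟨ cong parity (∑-cong t ∣edge∩A∣) ⟩
    parity (∑[ i < t ] (blockCount i + blockCount (suc i))) ≡⟨ cong parity (∑-+ t blockCount _) ⟩
    parity (∑< t blockCount + ∑[ i < t ] blockCount (1 + i)) ≡⟨ cong (λ x → parity (∑< t blockCount + x)) (∑-rotate t blockCount blockCount-periodic 1) ⟩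
    parity (∑< t blockCount + ∑< t blockCount)             ≡⟨ ℙ.+-homo-+ (∑< t blockCount) _ ⟩
    parity (∑< t blockCount) ℙ.+ parity (∑< t blockCount)  ≡⟨ ℙ.p+p≡0ℙ (parity (∑< t blockCount)) ⟩
    0ℙ                                                     ∎
    where open ≡-Reasoning

  -- If t = 2u, the edges 0, 2, …, 2u - 2 partition the vertex set, so the
  -- parity of |A| is u times the common parity of the edges.
  t-even⇒parity-∣A∣ : ∀ u {p} → t ≡ u * 2 → (∀ i → i < t → parity ∣ edge i ∩ A ∣ ≡ p) →
                      parity ∣ A ∣ ≡ parity u ℙ.* p
  t-even⇒parity-∣A∣ u {p} t≡2u edge-parity = begin
    parity ∣ A ∣                                                ≡⟨ cong parity (∣A∣-by-blocks 0) ⟩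
    parity (∑< t blockCount)                                    ≡⟨ cong (λ m → parity (∑< m blockCount)) t≡2u ⟩
    parity (∑< (u * 2) blockCount)                              ≡⟨ cong parity (∑-pairs u blockCount) ⟩
    parity (∑[ v < u ] (blockCount (v * 2) + blockCount (suc (v * 2)))) ≡⟨ parity-∑ u _ pair-parity ⟩
    parity u ℙ.* p                                              ∎
    where
    open ≡-Reasoning
    pair-parity : ∀ v → v < u → parity (blockCount (v * 2) + blockCount (suc (v * 2))) ≡ p
    pair-parity v v<u = trans (cong parity (sym (∣edge∩A∣ (v * 2))))
                              (edge-parity (v * 2) (subst (v * 2 <_) (sym t≡2u) (*-monoˡ-< 2 v<u)))

  InBlock : Fin n → ℕ → Set
  InBlock a c = ∃ λ j → j < h × vertexAt (c * h + j) ≡ a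

  edge⇒blocks : ∀ {a} i → a ∈ edge i → InBlock a i ⊎ InBlock a (suc i)
  edge⇒blocks i a∈edge with ∈segment⁻ a∈edge
  ... | j , j<2h , at-j with j <? h
  ...   | yes j<h = inj₁ (j , j<h , at-j)
  ...   | no  j≮h = inj₂ (j ∸ h , subst (j ∸ h <_) (m+n∸n≡m h h) (∸-monoˡ-< j<2h h≤j) , trans (cong vertexAt next) at-j)
    where
    h≤j : h ≤ j
    h≤j = ≮⇒≥ j≮h
    next : suc i * h + (j ∸ h) ≡ i * h + j
    next = trans (cong (_+ (j ∸ h)) (+-comm h (i * h)))
                 (trans (+-assoc (i * h) h _) (cong (i * h +_) (m+[n∸m]≡n h≤j)))

  edge⊆A⇒full-blocks : ∀ r → r < t → edge r ⊆ₛ A → blockCount r ≡ h × blockCount (suc r) ≡ h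
  edge⊆A⇒full-blocks r r<t edge⊆A = both-maximal (blockCount≤h r) (blockCount≤h (suc r)) (begin
    blockCount r + blockCount (suc r)  ≡⟨ sym (∣edge∩A∣ r) ⟩
    ∣ edge r ∩ A ∣                     ≡⟨ cong ∣_∣ (⊆-antisym (p∩q⊆p _ A) (λ x∈ → x∈p∩q⁺ (x∈ , edge⊆A x∈))) ⟩
    ∣ edge r ∣                         ≡⟨ cong ∣_∣ (sym (E≡edge r)) ⟩
    ∣ E r ∣                            ≡⟨ trans (edge-size r r<t) k≡h+h ⟩
    h + h                              ∎)
    where open ≡-Reasoning

  star⇒full-block : ∀ {a} r → r < t → edge r ⊆ₛ A → a ∈ edge r → ∃ λ c → InBlock a c × blockCount c ≡ h
  star⇒full-block r r<t edge⊆A a∈edge with edge⇒blocks r a∈edge | edge⊆A⇒full-blocks r r<t edge⊆A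
  ... | inj₁ in-r  | full-r , _      = r , in-r , full-r
  ... | inj₂ in-r′ | _      , full-r′ = suc r , in-r′ , full-r′

  -- If t = 2w + 1, a vertex of block c lies in none of the w edges
  -- c + 1, c + 3, …, c + 2w - 1, which only use the blocks c + 1, …, c + 2w.
  block-avoids-edges : ∀ {a c w v} → InBlock a c → t ≡ suc (w * 2) → v < w → a ∉ edge (suc c + v * 2)
  block-avoids-edges {a} {c} {w} {v} (j₀ , j₀<h , at-j₀) t≡2w+1 v<w a∈edge with ∈segment⁻ a∈edge
  ... | j , j<2h , at-j = <⇒≱ j₀<h (subst (h ≤_) (sym same) (m≤m+n h _))
    where
    offset-identity : ∀ c v h j → (suc c + v * 2) * h + j ≡ c * h + (h + (v * 2 * h + j))
    offset-identity = solve-∀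
    three-blocks : ∀ h v → h + (v * 2 * h + (h + h)) ≡ (suc v * 2 + 1) * h
    three-blocks = solve-∀
    offset : (suc c + v * 2) * h + j ≡ c * h + (h + (v * 2 * h + j))
    offset = offset-identity c v h j
    offset<n : h + (v * 2 * h + j) < n
    offset<n = begin-strict
      h + (v * 2 * h + j)            <⟨ +-monoʳ-< h (+-monoʳ-< (v * 2 * h) j<2h) ⟩
      h + (v * 2 * h + (h + h))      ≡⟨ three-blocks h v ⟩
      (suc v * 2 + 1) * h            ≤⟨ *-monoˡ-≤ h (+-monoˡ-≤ 1 (*-monoˡ-≤ 2 v<w)) ⟩
      (w * 2 + 1) * h                ≡⟨ cong (_* h) (trans (+-comm (w * 2) 1) (sym t≡2w+1)) ⟩
      t * h                          ≡⟨ t*h≡n ⟩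
      n                              ∎
      where open ≤-Reasoning
    same : j₀ ≡ h + (v * 2 * h + j)
    same = vertexAt-injective (c * h) (<-≤-trans j₀<h (≤-trans (m≤m+n h h) h+h≤n)) offset<n
             (trans at-j₀ (sym (trans (cong vertexAt (sym offset)) at-j)))

  -- If t is odd, not every edge can be odd (all-odd⇒t-even); in 𝓑′ the
  -- remaining edges are star edges.
  odd-t⇒star-edge : ∀ {a w} → t ≡ suc (w * 2) → (∀ i → 𝓑′ k A a (edge i)) →
                    ∃ λ r → r < t × Star k A a (edge r)
  odd-t⇒star-edge {a} {w} t≡2w+1 edge-type = from-dichotomy (all-or-exception t (λ i _ → edge-type i))
    where
    from-dichotomy : (∀ i → i < t → 𝓑 k A (edge i)) ⊎ (∃ λ r → r < t × Star k A a (edge r)) →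
                     ∃ λ r → r < t × Star k A a (edge r)
    from-dichotomy (inj₂ star)    = star
    from-dichotomy (inj₁ all-odd) = contradiction (trans (sym t-even) (trans (cong parity t≡2w+1) (parity-1+double w))) λ ()
      where
      t-even : parity t ≡ 0ℙ
      t-even = all-odd⇒t-even λ i i<t → odd⇒parity≡1ℙ ∣ edge i ∩ A ∣ (proj₂ (all-odd i i<t))

  -- Starting right after block c, the first 2w blocks pair up
  -- into w edges avoiding a, hence odd, and the last block is c itself; so
  -- |A| ≡ w + h (mod 2).
  full-block⇒parity-∣A∣ : ∀ {a c w} → InBlock a c → blockCount c ≡ h → t ≡ suc (w * 2) →
                          (∀ i → 𝓑′ k A a (edge i)) → parity ∣ A ∣ ≡ parity w ℙ.+ parity h
  full-block⇒parity-∣A∣ {a} {c} {w} a∈c full t≡2w+1 edge-type = begin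
    parity ∣ A ∣                                      ≡⟨ cong parity (∣A∣-by-blocks (suc c)) ⟩
    parity (∑< t f)                                   ≡⟨ cong (λ m → parity (∑< m f)) t≡2w+1 ⟩
    parity (∑< (suc (w * 2)) f)                       ≡⟨ cong parity (∑-last (w * 2) f) ⟩
    parity (∑< (w * 2) f + f (w * 2))                 ≡⟨ ℙ.+-homo-+ (∑< (w * 2) f) _ ⟩
    parity (∑< (w * 2) f) ℙ.+ parity (f (w * 2))      ≡⟨ cong₂ ℙ._+_ pairs-parity (cong parity last-block) ⟩
    parity w ℙ.* 1ℙ ℙ.+ parity h                      ≡⟨ cong (ℙ._+ parity h) (ℙ.*-identityʳ (parity w)) ⟩
    parity w ℙ.+ parity h                             ∎
    where
    open ≡-Reasoning
    f : ℕ → ℕ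
    f i = blockCount (suc c + i)
    pair-odd : ∀ v → v < w → parity (f (v * 2) + f (suc (v * 2))) ≡ 1ℙ
    pair-odd v v<w = from-edge-type (edge-type (suc c + v * 2))
      where
      pair≡edge : f (v * 2) + f (suc (v * 2)) ≡ ∣ edge (suc c + v * 2) ∩ A ∣
      pair≡edge = trans (cong (λ x → f (v * 2) + blockCount x) (+-suc (suc c) (v * 2)))
                        (sym (∣edge∩A∣ (suc c + v * 2)))
      from-edge-type : 𝓑′ k A a (edge (suc c + v * 2)) → parity (f (v * 2) + f (suc (v * 2))) ≡ 1ℙ
      from-edge-type (inj₁ (_ , odd))        = trans (cong parity pair≡edge) (odd⇒parity≡1ℙ ∣ edge (suc c + v * 2) ∩ A ∣ odd)
      from-edge-type (inj₂ (_ , _ , a∈edge)) = ⊥-elim (block-avoids-edges {c = c} {w = w} a∈c t≡2w+1 v<w a∈edge)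
    pairs-parity : parity (∑< (w * 2) f) ≡ parity w ℙ.* 1ℙ
    pairs-parity = trans (cong parity (∑-pairs w f)) (parity-∑ w _ pair-odd)
    last-block : f (w * 2) ≡ h
    last-block = begin
      blockCount (suc c + w * 2)  ≡⟨ cong blockCount (trans (+-comm (suc c) (w * 2)) (trans (+-suc (w * 2) c) (cong (_+ c) (sym t≡2w+1)))) ⟩
      blockCount (t + c)          ≡⟨ blockCount-periodic c ⟩
      blockCount c                ≡⟨ full ⟩
      h                           ∎

  odd-t⇒parity-∣A∣ : ∀ {a w} → t ≡ suc (w * 2) → (∀ i → 𝓑′ k A a (edge i)) →
                     parity ∣ A ∣ ≡ parity w ℙ.+ parity h
  odd-t⇒parity-∣A∣ {a} {w} t≡2w+1 edge-type with odd-t⇒star-edge {w = w} t≡2w+1 edge-type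
  ... | r , r<t , _ , edge⊆A , a∈edge with star⇒full-block {a} r r<t edge⊆A a∈edge
  ...   | c , a∈c , full = full-block⇒parity-∣A∣ {c = c} {w = w} a∈c full t≡2w+1 edge-type

  k∣n⇒t-even : k ∣ n → t ≡ t / 2 * 2
  k∣n⇒t-even k∣n = sym (m/n*n≡m (*-cancelʳ-∣ h (subst₂ _∣_ k≡2h (sym t*h≡n) k∣n)))

  k∤n⇒t-odd : ¬ k ∣ n → t ≡ suc (t / 2 * 2)
  k∤n⇒t-odd k∤n = parity≡1ℙ⇒odd-form t (¬2∣⇒parity≡1ℙ t λ 2∣t →
    k∤n (subst₂ _∣_ (sym k≡2h) t*h≡n (*-monoˡ-∣ h 2∣t)))

  n/k≡t/2 : .{{_ : NonZero k}} → n / k ≡ t / 2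
  n/k≡t/2 = begin
    n / k              ≡⟨ /-congˡ (sym t*h≡n) ⟩
    t * h / k          ≡⟨ /-congʳ k≡2h ⟩
    t * h / (2 * h)    ≡⟨ m*n/o*n≡m/o t h 2 ⟩
    t / 2              ∎
    where
    open ≡-Reasoning
    instance
      2h-nonZero : NonZero (2 * h)
      2h-nonZero = m*n≢0 2 h

1ℙ≢0ℙ : 1ℙ ≢ 0ℙ
1ℙ≢0ℙ ()

-- k ∣ n, all odd edges: |A| ≡ n/k, so n/k + |A| is even.
no-cycle-𝓑-k∣n : ∀ {n k h} .{{_ : NonZero k}} (k≡2h : k ≡ 2 * h) (A : Subset n) →
                 k ∣ n → Odd (n / k + ∣ A ∣) → ¬ HamiltonCycle k h n (𝓑 k A)
no-cycle-𝓑-k∣n {n} {k} k≡2h A k∣n odd cycle = 1ℙ≢0ℙ (begin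
  1ℙ                                          ≡⟨ sym (odd⇒parity≡1ℙ (n / k + ∣ A ∣) odd) ⟩
  parity (n / k + ∣ A ∣)                      ≡⟨ ℙ.+-homo-+ (n / k) ∣ A ∣ ⟩
  parity (n / k) ℙ.+ parity ∣ A ∣             ≡⟨ cong₂ ℙ._+_ (cong parity n/k≡t/2) ∣A∣-parity ⟩
  parity (t / 2) ℙ.+ (parity (t / 2) ℙ.* 1ℙ)  ≡⟨ cong (parity (t / 2) ℙ.+_) (ℙ.*-identityʳ _) ⟩
  parity (t / 2) ℙ.+ parity (t / 2)           ≡⟨ ℙ.p+p≡0ℙ (parity (t / 2)) ⟩
  0ℙ                                          ∎)
  where
  open HalfOverlapCycle k≡2h cycle A
  open HamiltonCycle cycle using (t)
  open ≡-Reasoning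
  ∣A∣-parity : parity ∣ A ∣ ≡ parity (t / 2) ℙ.* 1ℙ
  ∣A∣-parity = t-even⇒parity-∣A∣ (t / 2) (k∣n⇒t-even k∣n) λ i _ → odd⇒parity≡1ℙ ∣ edge i ∩ A ∣ (proj₂ (every-edge i))

-- k ∣ n, all even edges: |A| is even.
no-cycle-𝓑bar : ∀ {n k h} (k≡2h : k ≡ 2 * h) (A : Subset n) →
                k ∣ n → Odd ∣ A ∣ → ¬ HamiltonCycle k h n (𝓑bar k A)
no-cycle-𝓑bar k≡2h A k∣n odd cycle = 1ℙ≢0ℙ (begin
  1ℙ                         ≡⟨ sym (odd⇒parity≡1ℙ ∣ A ∣ odd) ⟩
  parity ∣ A ∣               ≡⟨ t-even⇒parity-∣A∣ (t / 2) (k∣n⇒t-even k∣n) edge-even ⟩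
  parity (t / 2) ℙ.* 0ℙ      ≡⟨ ℙ.*-zeroʳ (parity (t / 2)) ⟩
  0ℙ                         ∎)
  where
  open HalfOverlapCycle k≡2h cycle A
  open HamiltonCycle cycle using (t)
  open ≡-Reasoning
  edge-even : ∀ i → i < t → parity ∣ edge i ∩ A ∣ ≡ 0ℙ
  edge-even i _ = even⇒parity≡0ℙ ∣ edge i ∩ A ∣ (proj₂ (every-edge i))

-- k ∤ n, all odd edges: t is odd, contradicting the double count.
no-cycle-𝓑-k∤n : ∀ {n k h} (k≡2h : k ≡ 2 * h) (A : Subset n) →
                 ¬ k ∣ n → ¬ HamiltonCycle k h n (𝓑 k A)
no-cycle-𝓑-k∤n k≡2h A k∤n cycle = 1ℙ≢0ℙ (begin
  1ℙ                       ≡⟨ sym (parity-1+double (t / 2)) ⟩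
  parity (suc (t / 2 * 2)) ≡⟨ cong parity (sym (k∤n⇒t-odd k∤n)) ⟩
  parity t                 ≡⟨ all-odd⇒t-even edge-odd ⟩
  0ℙ                       ∎)
  where
  open HalfOverlapCycle k≡2h cycle A
  open HamiltonCycle cycle using (t)
  open ≡-Reasoning
  edge-odd : ∀ i → i < t → parity ∣ edge i ∩ A ∣ ≡ 1ℙ
  edge-odd i _ = odd⇒parity≡1ℙ ∣ edge i ∩ A ∣ (proj₂ (every-edge i))

𝓑′-cycle⇒parity : ∀ {n k h} .{{_ : NonZero k}} (k≡2h : k ≡ 2 * h) (A : Subset n) (a : Fin n) →
                  ¬ k ∣ n → HamiltonCycle k h n (𝓑′ k A a) → parity (n / k + ∣ A ∣) ≡ parity h
𝓑′-cycle⇒parity {n} {k} {h} k≡2h A a k∤n cycle = begin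
  parity (n / k + ∣ A ∣)                          ≡⟨ ℙ.+-homo-+ (n / k) ∣ A ∣ ⟩
  parity (n / k) ℙ.+ parity ∣ A ∣                 ≡⟨ cong₂ ℙ._+_ (cong parity n/k≡t/2) (odd-t⇒parity-∣A∣ {a} {t / 2} (k∤n⇒t-odd k∤n) every-edge) ⟩
  parity (t / 2) ℙ.+ (parity (t / 2) ℙ.+ parity h) ≡⟨ sym (ℙ.+-assoc (parity (t / 2)) _ _) ⟩
  parity (t / 2) ℙ.+ parity (t / 2) ℙ.+ parity h   ≡⟨ cong (ℙ._+ parity h) (ℙ.p+p≡0ℙ (parity (t / 2))) ⟩
  parity h                                        ∎
  where
  open HalfOverlapCycle k≡2h cycle A
  open HamiltonCycle cycle using (t)
  open ≡-Reasoning

proposition1p3 : (k n : ℕ) .{{_ : NonZero k}} → 4 ≤ k → 2 ∣ k → (k / 2) ∣ n →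
                 (H : HGraph n) → Hext n k H → ¬ HamiltonCycle k (k / 2) n H
proposition1p3 k n _ 2∣k _ H ext = refute ext
  where
  k≡2h : k ≡ 2 * (k / 2)
  k≡2h = sym (m*[n/m]≡n 2∣k)
  refute : Hext n k H → ¬ HamiltonCycle k (k / 2) n H
  refute (ext-B A k∣n odd)                = no-cycle-𝓑-k∣n k≡2h A k∣n odd
  refute (ext-Bbar A k∣n odd)             = no-cycle-𝓑bar k≡2h A k∣n odd
  refute (ext-B-half A _ k∤n)             = no-cycle-𝓑-k∤n k≡2h A k∤n
  refute (ext-B′-4 A a _ _ k∤n 4∣k odd) cycle = 1ℙ≢0ℙ (begin
    1ℙ                      ≡⟨ sym (odd⇒parity≡1ℙ (n / k + ∣ A ∣) odd) ⟩
    parity (n / k + ∣ A ∣)  ≡⟨ 𝓑′-cycle⇒parity k≡2h A a k∤n cycle ⟩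
    parity (k / 2)          ≡⟨ 4∣2h⇒parity≡0ℙ (k / 2) (subst (4 ∣_) k≡2h 4∣k) ⟩
    0ℙ                      ∎)
    where open ≡-Reasoning
  refute (ext-B′-2 A a _ _ k∤n _ 4∤k even) cycle = 1ℙ≢0ℙ (begin
    1ℙ                      ≡⟨ sym (4∤2h⇒parity≡1ℙ (k / 2) (4∤k ∘ subst (4 ∣_) (sym k≡2h))) ⟩
    parity (k / 2)          ≡⟨ sym (𝓑′-cycle⇒parity k≡2h A a k∤n cycle) ⟩
    parity (n / k + ∣ A ∣)  ≡⟨ even⇒parity≡0ℙ (n / k + ∣ A ∣) even ⟩
    0ℙ                      ∎)
    where open ≡-Reasoning
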